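{- For every $n\ge1$ there is a bijection between the set of staircase tableaux of size $n$ containing no $\gamma$ and no $\delta$ and the set of permutation tableaux of length $n+1$, and there is a bijection between the set of staircase tableaux of size $n$ containing no $\gamma$ and no $\delta$ and the set of alternative tableaux of length $n$.
   Context: A staircase tableau of size $n$ is a Young diagram of shape $(n,n-1,\dots,1)$ (English notation; the diagonal boxes are the last boxes of the rows) whose boxes are empty or labeled $\alpha,\beta,\gamma,\delta$, such that no diagonal box is empty, all boxes in the same row to the left of a $\beta$ or $\delta$ are empty, and all boxes in the same column above an $\alpha$ or $\gamma$ are empty. A permutation tableau is a Young diagram (rows are allowed to have length $0$, i.e. the diagram has a specified number of rows and columns, determined by its southeast boundary path) whose boxes are filled with $0$'s and $1$'s such that every column contains at least one $1$, and no $0$ has simultaneously a $1$ above it in the same column and a $1$ to its left in the same row; its length is its number of rows plus its number of columns. An alternative tableau is a Young diagram in which rows and columns may have length $0$ (i.e. specified by a boundary lattice path), whose boxes are empty or contain a left arrow $\leftarrow$ or an up arrow $\uparrow$, such that all boxes to the left of a $\leftarrow$ in its row are empty and all boxes above a $\uparrow$ in its column are empty; its length is its number of rows plus its number of columns. -}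

module Defs where

open import Data.Nat using (ℕ; zero; suc; _+_; _<_)
open import Data.Fin using (Fin; toℕ)
open import Data.Maybe using (Maybe; just; nothing)
open import Data.Bool using (Bool; true; false)
open import Data.Empty using (⊥)
open import Data.Unit using (⊤)
open import Data.Product using (Σ; _×_; _,_; proj₁; proj₂; ∃)
open import Relation.Binary.PropositionalEquality
  using (_≡_; _≢_; refl; sym; trans)
open import Relation.Binary.Bundles using (Setoid)
open import Relation.Binary.Structures using (IsEquivalence)
open import Level using (0ℓ)

data Label : Set where
  α β γ δ : Label

-- English notation: row i (top row i = 0) and column j (leftmost j = 0),
-- both in Fin n.  Row i has length n - i, so box (i , j) exists iff
-- i + j < n; the diagonal boxes (last box of each row) are i + j = n - 1.
InStair : ∀ {n} → Fin n → Fin n → Set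
InStair {n} i j = toℕ i + toℕ j < n

OnDiag : ∀ {n} → Fin n → Fin n → Set
OnDiag {n} i j = suc (toℕ i + toℕ j) ≡ n

RowBlocking : Label → Set
RowBlocking β = ⊤
RowBlocking δ = ⊤
RowBlocking α = ⊥
RowBlocking γ = ⊥

ColBlocking : Label → Set
ColBlocking α = ⊤
ColBlocking γ = ⊤
ColBlocking β = ⊥
ColBlocking δ = ⊥

-- a filling: nothing = empty box, just l = box labelled l
-- (values outside the staircase shape are irrelevant)
record IsStaircase {n : ℕ} (T : Fin n → Fin n → Maybe Label) : Set where
  field
    diagNonEmpty : ∀ i j → OnDiag i j → T i j ≢ nothing
    rowEmpty : ∀ i j l → InStair i j → T i j ≡ just l → RowBlocking l →
               ∀ j' → toℕ j' < toℕ j → T i j' ≡ nothing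
    colEmpty : ∀ i j l → InStair i j → T i j ≡ just l → ColBlocking l →
               ∀ i' → toℕ i' < toℕ i → T i' j ≡ nothing

NoγNoδ : ∀ {n} → (Fin n → Fin n → Maybe Label) → Set
NoγNoδ {n} T = ∀ i j → InStair {n} i j → (T i j ≢ just γ) × (T i j ≢ just δ)

record StaircaseαβTableau (n : ℕ) : Set where
  field
    fill      : Fin n → Fin n → Maybe Label
    staircase : IsStaircase fill
    noγδ      : NoγNoδ fill

_≈St_ : ∀ {n} → StaircaseαβTableau n → StaircaseαβTableau n → Set
_≈St_ {n} S T = ∀ i j → InStair {n} i j →
  StaircaseαβTableau.fill S i j ≡ StaircaseαβTableau.fill T i j

StaircaseαβSetoid : ℕ → Setoid 0ℓ 0ℓ
StaircaseαβSetoid n = record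
  { Carrier = StaircaseαβTableau n
  ; _≈_ = _≈St_
  ; isEquivalence = record
    { refl = λ i j _ → refl
    ; sym = λ p i j b → sym (p i j b)
    ; trans = λ p q i j b → trans (p i j b) (q i j b)
    }
  }

-- The southeast boundary path of a diagram with k rows and N - k columns
-- (inside a k × (N - k) rectangle), read from the NE corner to the SW
-- corner: a south step is a row, a west step is a column.  Row p (a south
-- step at position p) meets column q (a west step at position q) in a box
-- iff p < q.  Rows with smaller p are higher; columns with larger q are
-- further left.  Rows and columns of length 0 are thereby allowed.
data Step : Set where
  south west : Step

Path : ℕ → Set
Path N = Fin N → Step

Box : ∀ {N} → Path N → Fin N → Fin N → Set
Box w p q = (toℕ p < toℕ q) × (w p ≡ south) × (w q ≡ west)

-- Permutation tableaux (true = 1, false = 0)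

record IsPermutationTableau {N : ℕ} (w : Path N) (f : Fin N → Fin N → Bool)
  : Set where
  field
    columnHasOne : ∀ q → w q ≡ west → ∃ λ p → Box w p q × (f p q ≡ true)
    noBadZero : ∀ p q → Box w p q → f p q ≡ false →
      (∃ λ p' → Box w p' q × (toℕ p' < toℕ p) × (f p' q ≡ true)) →
      -- a 1 to its left in the same row
      (∃ λ q' → Box w p q' × (toℕ q < toℕ q') × (f p q' ≡ true)) → ⊥

record PermutationTableau (N : ℕ) : Set where
  field
    path   : Path N
    fill   : Fin N → Fin N → Bool
    isPerm : IsPermutationTableau path fill

_≈Pt_ : ∀ {N} → PermutationTableau N → PermutationTableau N → Set
S ≈Pt T = (∀ p → path S p ≡ path T p) ×
          (∀ p q → Box (path S) p q → fill S p q ≡ fill T p q)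
  where open PermutationTableau

private
  box-transport : ∀ {N} {w w' : Path N} → (∀ p → w p ≡ w' p) →
                  ∀ {p q} → Box w p q → Box w' p q
  box-transport e {p} {q} (lt , s , t) =
    lt , trans (sym (e p)) s , trans (sym (e q)) t

PermutationTableauSetoid : ℕ → Setoid 0ℓ 0ℓ
PermutationTableauSetoid N = record
  { Carrier = PermutationTableau N
  ; _≈_ = _≈Pt_
  ; isEquivalence = record
    { refl = (λ p → refl) , (λ p q _ → refl)
    ; sym = λ { (e , g) → (λ p → sym (e p)) ,
                          (λ p q b → sym (g p q (box-transport (λ r → sym (e r)) b))) }
    ; trans = λ { (e , g) (e' , g') → (λ p → trans (e p) (e' p)) ,
                   (λ p q b → trans (g p q b) (g' p q (box-transport e b))) }
    }
  }

data Arrow : Set where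
  leftArrow upArrow : Arrow

record IsAlternativeTableau {N : ℕ} (w : Path N) (f : Fin N → Fin N → Maybe Arrow)
  : Set where
  field
    leftEmpty : ∀ p q → Box w p q → f p q ≡ just leftArrow →
      ∀ q' → Box w p q' → toℕ q < toℕ q' → f p q' ≡ nothing
    aboveEmpty : ∀ p q → Box w p q → f p q ≡ just upArrow →
      ∀ p' → Box w p' q → toℕ p' < toℕ p → f p' q ≡ nothing

record AlternativeTableau (N : ℕ) : Set where
  field
    path  : Path N
    fill  : Fin N → Fin N → Maybe Arrow
    isAlt : IsAlternativeTableau path fill

_≈At_ : ∀ {N} → AlternativeTableau N → AlternativeTableau N → Set
S ≈At T = (∀ p → path S p ≡ path T p) ×
          (∀ p q → Box (path S) p q → fill S p q ≡ fill T p q)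
  where open AlternativeTableau

AlternativeTableauSetoid : ℕ → Setoid 0ℓ 0ℓ
AlternativeTableauSetoid N = record
  { Carrier = AlternativeTableau N
  ; _≈_ = _≈At_
  ; isEquivalence = record
    { refl = (λ p → refl) , (λ p q _ → refl)
    ; sym = λ { (e , g) → (λ p → sym (e p)) ,
                          (λ p q b → sym (g p q (box-transport (λ r → sym (e r)) b))) }
    ; trans = λ { (e , g) (e' , g') → (λ p → trans (e p) (e' p)) ,
                   (λ p q b → trans (g p q b) (g' p q (box-transport e b))) }
    }
  }

module Submission where

-- A staircase tableau S of size n without γ, δ is an alternative
-- tableau of length n written in the staircase with its columns reversed:
-- the diagonal box of row p is step p of the path (α a row, β a column) and
-- the box (p , opposite q) above the diagonal is the box (p , q) of the
-- alternative tableau (α = ↑, β = ←).  The staircase conditions say exactly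
-- that a nonempty box above the diagonal lies in an α-row and a β-column
-- (offDiagonal-box), which makes this a bijection.
--
-- An alternative tableau A of length n becomes a permutation
-- tableau of length n + 1 by adding a row on top: the 1's are the ↑'s, the
-- boxes no arrow points to, and, in the top row, the columns without ↑.
-- Conversely the ↑'s are recovered as the topmost 1's of the columns and
-- the ←'s as the rightmost 0's having a 1 above them.
--
-- Both parts are setoid inverses; the theorem composes them.

open import Defs
open import Data.Nat using (ℕ; zero; suc; _≤_; _<_; _+_; _∸_; z≤n; s≤s; _<?_; _≤?_)
open import Data.Nat.Properties
  using (+-comm; +-suc; ∸-monoʳ-<; m+n≤o⇒m≤o∸n; m≤o∸n⇒m+n≤o; m+n∸n≡m; m∸n+n≡m; ≤-refl; ≤-trans;
         <-trans; <-≤-trans; ≤-<-trans; <⇒≤; <⇒≢; ≮⇒≥; m≤n⇒m<n∨m≡n; <-cmp)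
open import Data.Fin using (Fin; zero; suc; toℕ; opposite)
open import Data.Fin.Properties using (any?; all?; opposite-prop; opposite-involutive; toℕ-injective; toℕ<n)
open import Data.Bool using (Bool; true; false)
open import Data.Bool.Properties using (¬-not) renaming (_≟_ to _≟ᵇ_)
open import Data.Maybe using (Maybe; just; nothing)
open import Data.Maybe.Properties using (just-injective)
open import Data.Product using (∃; _×_; _,_; proj₁; proj₂)
open import Data.Sum using (_⊎_; inj₁; inj₂)
open import Data.Empty using (⊥; ⊥-elim)
open import Data.Unit using (tt)
open import Function.Base using (case_of_; _∘_)
open import Function.Bundles using (Bijection; Inverse; mk⇔)
open import Function.Consequences.Setoid using (strictlyInverseˡ⇒inverseˡ; strictlyInverseʳ⇒inverseʳ)
open import Function.Construct.Composition using () renaming (inverse to _∘ᵢ_)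
open import Function.Properties.Inverse using (Inverse⇒Bijection)
open import Relation.Nullary using (Dec; yes; no; ¬_; does; ¬?)
open import Relation.Nullary.Decidable using (dec-true; dec-false; does-⇔; _×-dec_; _⊎-dec_; _→-dec_)
open import Relation.Binary.Definitions using (tri<; tri≈; tri>)
open import Relation.Binary.PropositionalEquality
open import Relation.Binary.Bundles using (Setoid)
open import Level using (0ℓ)

mkInverse : (S T : Setoid 0ℓ 0ℓ) → let module S = Setoid S; module T = Setoid T in
  (to : S.Carrier → T.Carrier) (from : T.Carrier → S.Carrier) →
  (∀ {x y} → x S.≈ y → to x T.≈ to y) → (∀ {x y} → x T.≈ y → from x S.≈ from y) →
  (∀ y → to (from y) T.≈ y) → (∀ x → from (to x) S.≈ x) → Inverse S T
mkInverse S T to from to-cong from-cong to∘from from∘to = record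
  { to = to ; from = from ; to-cong = to-cong ; from-cong = from-cong
  ; inverse = strictlyInverseˡ⇒inverseˡ S T to-cong to∘from
            , strictlyInverseʳ⇒inverseʳ S T from-cong from∘to }

Box-resp : ∀ {N} {w w' : Path N} → (∀ p → w p ≡ w' p) → ∀ {p q} → Box w p q → Box w' p q
Box-resp e {p} {q} (lt , s , t) = lt , trans (sym (e p)) s , trans (sym (e q)) t

-- Part I: staircase tableaux without γ, δ and alternative tableaux.

-- Reversing the columns of the staircase: box (i , j) corresponds to the
-- pair (i , opposite j), and lies in the staircase iff i ≤ opposite j, on
-- the diagonal iff i = opposite j.
opposite-reverses : ∀ {n} {q q' : Fin n} → toℕ q < toℕ q' → toℕ (opposite q') < toℕ (opposite q)
opposite-reverses {n} {q} {q'} q<q' rewrite opposite-prop q | opposite-prop q' =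
  ∸-monoʳ-< (s≤s q<q') (toℕ<n q')

inStair⇒≤opposite : ∀ {n} {i j : Fin n} → InStair i j → toℕ i ≤ toℕ (opposite j)
inStair⇒≤opposite {n} {i} {j} ins rewrite opposite-prop j =
  m+n≤o⇒m≤o∸n (toℕ i) (subst (_≤ n) (sym (+-suc (toℕ i) (toℕ j))) ins)

≤⇒inStair-opposite : ∀ {n} {i q : Fin n} → toℕ i ≤ toℕ q → InStair i (opposite q)
≤⇒inStair-opposite {n} {i} {q} i≤q =
  subst (_≤ n) (+-suc (toℕ i) (toℕ (opposite q)))
    (m≤o∸n⇒m+n≤o (toℕ i) (toℕ<n (opposite q)) i≤n∸q')
  where
  i≤n∸q' : toℕ i ≤ n ∸ suc (toℕ (opposite q))
  i≤n∸q' = subst (toℕ i ≤_)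
    (trans (cong toℕ (sym (opposite-involutive q))) (opposite-prop (opposite q))) i≤q

onDiag⇒≡opposite : ∀ {n} {i j : Fin n} → OnDiag i j → toℕ i ≡ toℕ (opposite j)
onDiag⇒≡opposite {n} {i} {j} od = begin
  toℕ i                         ≡⟨ m+n∸n≡m (toℕ i) (toℕ j) ⟨
  suc (toℕ i + toℕ j) ∸ suc (toℕ j) ≡⟨ cong (_∸ suc (toℕ j)) od ⟩
  n ∸ suc (toℕ j)               ≡⟨ opposite-prop j ⟨
  toℕ (opposite j)              ∎
  where open ≡-Reasoning

onDiag-opposite : ∀ {n} (p : Fin n) → OnDiag p (opposite p)
onDiag-opposite {n} p = begin
  suc (toℕ p + toℕ (opposite p))     ≡⟨ cong (λ x → suc (toℕ p + x)) (opposite-prop p) ⟩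
  suc (toℕ p + (n ∸ suc (toℕ p)))    ≡⟨ cong suc (+-comm (toℕ p) _) ⟩
  suc (n ∸ suc (toℕ p) + toℕ p)      ≡⟨ +-suc (n ∸ suc (toℕ p)) (toℕ p) ⟨
  n ∸ suc (toℕ p) + suc (toℕ p)      ≡⟨ m∸n+n≡m (toℕ<n p) ⟩
  n                                  ∎
  where open ≡-Reasoning

arrowOfLabel : Maybe Label → Maybe Arrow
arrowOfLabel (just α) = just upArrow
arrowOfLabel (just β) = just leftArrow
arrowOfLabel _        = nothing

labelOfArrow : Maybe Arrow → Maybe Label
labelOfArrow (just upArrow)   = just α
labelOfArrow (just leftArrow) = just β
labelOfArrow nothing          = nothing

arrowOfStep : Step → Arrow
arrowOfStep south = upArrow
arrowOfStep west  = leftArrow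

stepOfArrow : Maybe Arrow → Step
stepOfArrow (just upArrow) = south
stepOfArrow _              = west

stepOfArrow-arrowOfStep : ∀ s → stepOfArrow (just (arrowOfStep s)) ≡ s
stepOfArrow-arrowOfStep south = refl
stepOfArrow-arrowOfStep west  = refl

diagonal-step : ∀ {s a} → arrowOfStep s ≡ a → s ≡ stepOfArrow (just a)
diagonal-step {s} refl = sym (stepOfArrow-arrowOfStep s)

arrowOfLabel-labelOfArrow : ∀ x → arrowOfLabel (labelOfArrow x) ≡ x
arrowOfLabel-labelOfArrow (just upArrow)   = refl
arrowOfLabel-labelOfArrow (just leftArrow) = refl
arrowOfLabel-labelOfArrow nothing          = refl

arrowOfLabel-just : ∀ m {a} → arrowOfLabel m ≡ just a → m ≡ labelOfArrow (just a)
arrowOfLabel-just (just α) refl = refl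
arrowOfLabel-just (just β) refl = refl
arrowOfLabel-just (just γ) ()
arrowOfLabel-just (just δ) ()
arrowOfLabel-just nothing  ()

αβOrEmpty : Maybe Label → Set
αβOrEmpty m = (m ≢ just γ) × (m ≢ just δ)

labelOfArrow-arrowOfLabel : ∀ m → αβOrEmpty m → labelOfArrow (arrowOfLabel m) ≡ m
labelOfArrow-arrowOfLabel (just α) _        = refl
labelOfArrow-arrowOfLabel (just β) _        = refl
labelOfArrow-arrowOfLabel (just γ) (¬γ , _) = ⊥-elim (¬γ refl)
labelOfArrow-arrowOfLabel (just δ) (_ , ¬δ) = ⊥-elim (¬δ refl)
labelOfArrow-arrowOfLabel nothing  _        = refl

labelOfArrow-αβ : ∀ x → αβOrEmpty (labelOfArrow x)
labelOfArrow-αβ (just upArrow)   = (λ ()) , (λ ())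
labelOfArrow-αβ (just leftArrow) = (λ ()) , (λ ())
labelOfArrow-αβ nothing          = (λ ()) , (λ ())

labelOfArrow-just : ∀ a → labelOfArrow (just a) ≢ nothing
labelOfArrow-just upArrow   ()
labelOfArrow-just leftArrow ()

rowBlocking⇒left : ∀ x {l} → labelOfArrow x ≡ just l → RowBlocking l → x ≡ just leftArrow
rowBlocking⇒left (just upArrow)   refl ()
rowBlocking⇒left (just leftArrow) _    _ = refl
rowBlocking⇒left nothing          ()

colBlocking⇒up : ∀ x {l} → labelOfArrow x ≡ just l → ColBlocking l → x ≡ just upArrow
colBlocking⇒up (just upArrow)   _    _ = refl
colBlocking⇒up (just leftArrow) refl ()
colBlocking⇒up nothing          ()

module _ {n : ℕ} where

  -- Decoding an alternative tableau (w , f): cellArrow w f p q is the arrow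
  -- that the staircase box (p , opposite q) encodes.
  boxArrow : Step → Step → Maybe Arrow → Maybe Arrow
  boxArrow south west  x = x
  boxArrow south south _ = nothing
  boxArrow west  _     _ = nothing

  boxArrow-just : ∀ s t {x a} → boxArrow s t x ≡ just a → s ≡ south × t ≡ west × x ≡ just a
  boxArrow-just south west  e = refl , refl , e
  boxArrow-just south south ()
  boxArrow-just west  _     ()

  boxArrow-nothing : ∀ s t {x} → (s ≡ south → t ≡ west → x ≡ nothing) → boxArrow s t x ≡ nothing
  boxArrow-nothing south west  empty = empty refl refl
  boxArrow-nothing south south _     = refl
  boxArrow-nothing west  _     _     = refl

  boxArrow-resp : ∀ s t {x y} → (s ≡ south → t ≡ west → x ≡ y) → boxArrow s t x ≡ boxArrow s t y
  boxArrow-resp south west  same = same refl refl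
  boxArrow-resp south south _    = refl
  boxArrow-resp west  _     _    = refl

  cellArrow : Path n → (Fin n → Fin n → Maybe Arrow) → Fin n → Fin n → Maybe Arrow
  cellArrow w f p q with <-cmp (toℕ p) (toℕ q)
  ... | tri< _ _ _ = boxArrow (w p) (w q) (f p q)
  ... | tri≈ _ _ _ = just (arrowOfStep (w p))
  ... | tri> _ _ _ = nothing

  cellArrow-cong : ∀ {w w' f f'} → (∀ p → w p ≡ w' p) → (∀ p q → Box w p q → f p q ≡ f' p q) →
                   ∀ p q → cellArrow w f p q ≡ cellArrow w' f' p q
  cellArrow-cong {w} {w'} {f} {f'} pe fe p q with <-cmp (toℕ p) (toℕ q)
  ... | tri< p<q _ _ = trans (boxArrow-resp (w p) (w q) (λ wp wq → fe p q (p<q , wp , wq)))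
                             (cong₂ (λ s t → boxArrow s t (f' p q)) (pe p) (pe q))
  ... | tri≈ _ _ _   = cong (just ∘ arrowOfStep) (pe p)
  ... | tri> _ _ _   = refl

  module _ (w : Path n) (f : Fin n → Fin n → Maybe Arrow) where

    cellArrow-diagonal : ∀ {p q} → toℕ p ≡ toℕ q → cellArrow w f p q ≡ just (arrowOfStep (w p))
    cellArrow-diagonal {p} {q} p≡q with <-cmp (toℕ p) (toℕ q)
    ... | tri< _ p≢q _ = ⊥-elim (p≢q p≡q)
    ... | tri≈ _ _ _   = refl
    ... | tri> _ p≢q _ = ⊥-elim (p≢q p≡q)

    cellArrow-box : ∀ {p q} → Box w p q → cellArrow w f p q ≡ f p q
    cellArrow-box {p} {q} (p<q , wp , wq) with <-cmp (toℕ p) (toℕ q)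
    ... | tri< _ _ _   rewrite wp | wq = refl
    ... | tri≈ p≮q _ _ = ⊥-elim (p≮q p<q)
    ... | tri> p≮q _ _ = ⊥-elim (p≮q p<q)

    cellArrow-empty : ∀ {p q} → toℕ p ≢ toℕ q → (Box w p q → f p q ≡ nothing) →
                      cellArrow w f p q ≡ nothing
    cellArrow-empty {p} {q} p≢q empty with <-cmp (toℕ p) (toℕ q)
    ... | tri≈ _ p≡q _ = ⊥-elim (p≢q p≡q)
    ... | tri> _ _ _   = refl
    ... | tri< p<q _ _ = boxArrow-nothing (w p) (w q) (λ wp wq → empty (p<q , wp , wq))

    cellArrow-just : ∀ {p q a} → cellArrow w f p q ≡ just a →
      (Box w p q × f p q ≡ just a) ⊎ (toℕ p ≡ toℕ q × arrowOfStep (w p) ≡ a)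
    cellArrow-just {p} {q} e with <-cmp (toℕ p) (toℕ q)
    ... | tri≈ _ p≡q _ = inj₂ (p≡q , just-injective e)
    ... | tri> _ _ _ with () ← e
    ... | tri< p<q _ _ with boxArrow-just (w p) (w q) e
    ...   | wp , wq , e' = inj₁ ((p<q , wp , wq) , e')

  module _ (S : StaircaseαβTableau n) where
    open StaircaseαβTableau S
    open IsStaircase staircase

    stairPath : Path n
    stairPath p = stepOfArrow (arrowOfLabel (fill p (opposite p)))

    stairArrows : Fin n → Fin n → Maybe Arrow
    stairArrows p q = arrowOfLabel (fill p (opposite q))

    diagonal-αβ : ∀ p → (fill p (opposite p) ≡ just α) ⊎ (fill p (opposite p) ≡ just β)
    diagonal-αβ p with fill p (opposite p) in e
    ... | just α  = inj₁ refl
    ... | just β  = inj₂ refl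
    ... | just γ  = ⊥-elim (proj₁ (noγδ p (opposite p) (≤⇒inStair-opposite ≤-refl)) e)
    ... | just δ  = ⊥-elim (proj₂ (noγδ p (opposite p) (≤⇒inStair-opposite ≤-refl)) e)
    ... | nothing = ⊥-elim (diagNonEmpty p (opposite p) (onDiag-opposite p) e)

    -- a nonempty box above the diagonal lies in a row with α and a column
    -- with β on the diagonal (β empties its row, α its column): it is a box
    -- of the alternative tableau
    offDiagonal-box : ∀ {i q} → toℕ i < toℕ q → fill i (opposite q) ≢ nothing →
                      Box stairPath i q
    offDiagonal-box {i} {q} i<q nonempty = i<q , rowStep (diagonal-αβ i) , colStep (diagonal-αβ q)
      where
      rowStep : (fill i (opposite i) ≡ just α) ⊎ (fill i (opposite i) ≡ just β) → stairPath i ≡ south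
      rowStep (inj₁ e) = cong (stepOfArrow ∘ arrowOfLabel) e
      rowStep (inj₂ e) = ⊥-elim (nonempty (rowEmpty i (opposite i) β
        (≤⇒inStair-opposite ≤-refl) e tt (opposite q) (opposite-reverses i<q)))
      colStep : (fill q (opposite q) ≡ just α) ⊎ (fill q (opposite q) ≡ just β) → stairPath q ≡ west
      colStep (inj₁ e) = ⊥-elim (nonempty (colEmpty q (opposite q) α
        (≤⇒inStair-opposite ≤-refl) e tt i i<q))
      colStep (inj₂ e) = cong (stepOfArrow ∘ arrowOfLabel) e

    diagonal-decode : ∀ p → labelOfArrow (just (arrowOfStep (stairPath p))) ≡ fill p (opposite p)
    diagonal-decode p with diagonal-αβ p
    ... | inj₁ e rewrite e = refl
    ... | inj₂ e rewrite e = refl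

    cellArrow-decode : ∀ {i q} → toℕ i ≤ toℕ q →
                       labelOfArrow (cellArrow stairPath stairArrows i q) ≡ fill i (opposite q)
    cellArrow-decode {i} {q} i≤q with m≤n⇒m<n∨m≡n i≤q
    ... | inj₂ i≡q = begin
      labelOfArrow (cellArrow stairPath stairArrows i q)
        ≡⟨ cong labelOfArrow (cellArrow-diagonal stairPath stairArrows i≡q) ⟩
      labelOfArrow (just (arrowOfStep (stairPath i)))  ≡⟨ diagonal-decode i ⟩
      fill i (opposite i)                              ≡⟨ cong (fill i ∘ opposite) (toℕ-injective i≡q) ⟩
      fill i (opposite q)                              ∎
      where open ≡-Reasoning
    ... | inj₁ i<q with fill i (opposite q) in e
    ...   | nothing = cong labelOfArrow (cellArrow-empty stairPath stairArrows (<⇒≢ i<q)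
                        (λ _ → cong arrowOfLabel e))
    ...   | just l  = begin
      labelOfArrow (cellArrow stairPath stairArrows i q)
        ≡⟨ cong labelOfArrow (cellArrow-box stairPath stairArrows
              (offDiagonal-box i<q λ e' → case trans (sym e) e' of λ ())) ⟩
      labelOfArrow (arrowOfLabel (fill i (opposite q)))
        ≡⟨ labelOfArrow-arrowOfLabel _ (noγδ i (opposite q) (≤⇒inStair-opposite i≤q)) ⟩
      fill i (opposite q) ≡⟨ e ⟩
      just l ∎
      where open ≡-Reasoning

    stairIsAlternative : IsAlternativeTableau stairPath stairArrows
    stairIsAlternative = record { leftEmpty = leftEmpty' ; aboveEmpty = aboveEmpty' }
      where
      leftEmpty' : ∀ p q → Box stairPath p q → stairArrows p q ≡ just leftArrow →
        ∀ q' → Box stairPath p q' → toℕ q < toℕ q' → stairArrows p q' ≡ nothing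
      leftEmpty' p q (p<q , _) e q' _ q<q' =
        cong arrowOfLabel (rowEmpty p (opposite q) β (≤⇒inStair-opposite (<⇒≤ p<q))
          (arrowOfLabel-just (fill p (opposite q)) e) tt (opposite q') (opposite-reverses q<q'))
      aboveEmpty' : ∀ p q → Box stairPath p q → stairArrows p q ≡ just upArrow →
        ∀ p' → Box stairPath p' q → toℕ p' < toℕ p → stairArrows p' q ≡ nothing
      aboveEmpty' p q (p<q , _) e p' _ p'<p =
        cong arrowOfLabel (colEmpty p (opposite q) α (≤⇒inStair-opposite (<⇒≤ p<q))
          (arrowOfLabel-just (fill p (opposite q)) e) tt p' p'<p)

  toAlternative : StaircaseαβTableau n → AlternativeTableau n
  toAlternative S = record { path = stairPath S ; fill = stairArrows S ; isAlt = stairIsAlternative S }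

  module _ (A : AlternativeTableau n) where
    open AlternativeTableau A renaming (path to w; fill to f)
    open IsAlternativeTableau isAlt

    altFill : Fin n → Fin n → Maybe Label
    altFill i j = labelOfArrow (cellArrow w f i (opposite j))

    -- a ← (as β) empties the boxes to its left: off the diagonal by the
    -- rule of alternative tableaux, on the diagonal since a west step has
    -- no boxes in its row
    altFill-rowEmpty : ∀ i j l → InStair i j → altFill i j ≡ just l → RowBlocking l →
                       ∀ j' → toℕ j' < toℕ j → altFill i j' ≡ nothing
    altFill-rowEmpty i j l _ e rb j' j'<j
      with cellArrow-just w f (rowBlocking⇒left (cellArrow w f i (opposite j)) e rb)
    ... | inj₁ (box@(i<q , _) , fe) =
      cong labelOfArrow (cellArrow-empty w f (<⇒≢ (<-trans i<q q<q'))
        (λ box' → leftEmpty i (opposite j) box fe (opposite j') box' q<q'))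
      where q<q' = opposite-reverses j'<j
    ... | inj₂ (i≡q , ae) =
      cong labelOfArrow (cellArrow-empty w f (<⇒≢ (subst (_< _) (sym i≡q) q<q'))
        (λ (_ , wi , _) → case trans (sym (diagonal-step ae)) wi of λ ()))
      where q<q' = opposite-reverses j'<j

    altFill-colEmpty : ∀ i j l → InStair i j → altFill i j ≡ just l → ColBlocking l →
                       ∀ i' → toℕ i' < toℕ i → altFill i' j ≡ nothing
    altFill-colEmpty i j l _ e cb i' i'<i
      with cellArrow-just w f (colBlocking⇒up (cellArrow w f i (opposite j)) e cb)
    ... | inj₁ (box@(i<q , _) , fu) =
      cong labelOfArrow (cellArrow-empty w f (<⇒≢ (<-trans i'<i i<q))
        (λ box' → aboveEmpty i (opposite j) box fu i' box' i'<i))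
    ... | inj₂ (i≡q , ae) =
      cong labelOfArrow (cellArrow-empty w f (<⇒≢ (subst (toℕ i' <_) i≡q i'<i))
        (λ (_ , _ , wq) → case trans (sym wq) (trans (cong w (toℕ-injective (sym i≡q)))
                                 (diagonal-step ae)) of λ ()))

  toStaircase : AlternativeTableau n → StaircaseαβTableau n
  toStaircase A = record
    { fill = altFill A
    ; staircase = record
      { diagNonEmpty = λ i j od e → labelOfArrow-just _ (trans
          (sym (cong labelOfArrow (cellArrow-diagonal w f {i} {opposite j} (onDiag⇒≡opposite od)))) e)
      ; rowEmpty = altFill-rowEmpty A
      ; colEmpty = altFill-colEmpty A }
    ; noγδ = λ i j _ → labelOfArrow-αβ (cellArrow w f i (opposite j)) }
    where open AlternativeTableau A renaming (path to w; fill to f)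

  toAlternative-cong : ∀ {S T} → S ≈St T → toAlternative S ≈At toAlternative T
  toAlternative-cong S≈T =
      (λ p → cong (stepOfArrow ∘ arrowOfLabel) (S≈T p (opposite p) (≤⇒inStair-opposite ≤-refl)))
    , (λ p q (p<q , _) → cong arrowOfLabel (S≈T p (opposite q) (≤⇒inStair-opposite (<⇒≤ p<q))))

  toStaircase-cong : ∀ {A B} → A ≈At B → toStaircase A ≈St toStaircase B
  toStaircase-cong (pe , fe) i j _ = cong labelOfArrow (cellArrow-cong pe fe i (opposite j))

  toAlternative-toStaircase : ∀ A → toAlternative (toStaircase A) ≈At A
  toAlternative-toStaircase A = pathEq , fillEq
    where
    open AlternativeTableau A renaming (path to w; fill to f)
    open ≡-Reasoning
    decode : ∀ p q → arrowOfLabel (altFill A p (opposite q)) ≡ cellArrow w f p q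
    decode p q = begin
      arrowOfLabel (labelOfArrow (cellArrow w f p (opposite (opposite q))))
        ≡⟨ arrowOfLabel-labelOfArrow _ ⟩
      cellArrow w f p (opposite (opposite q))
        ≡⟨ cong (cellArrow w f p) (opposite-involutive q) ⟩
      cellArrow w f p q ∎
    pathEq : ∀ p → stairPath (toStaircase A) p ≡ w p
    pathEq p = begin
      stepOfArrow (arrowOfLabel (altFill A p (opposite p))) ≡⟨ cong stepOfArrow (decode p p) ⟩
      stepOfArrow (cellArrow w f p p)                       ≡⟨ cong stepOfArrow (cellArrow-diagonal w f refl) ⟩
      stepOfArrow (just (arrowOfStep (w p)))                ≡⟨ stepOfArrow-arrowOfStep (w p) ⟩
      w p                                                   ∎
    fillEq : ∀ p q → Box (stairPath (toStaircase A)) p q → stairArrows (toStaircase A) p q ≡ f p q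
    fillEq p q box = trans (decode p q) (cellArrow-box w f (Box-resp pathEq box))

  toStaircase-toAlternative : ∀ S → toStaircase (toAlternative S) ≈St S
  toStaircase-toAlternative S i j ins =
    trans (cellArrow-decode S (inStair⇒≤opposite ins))
          (cong (StaircaseαβTableau.fill S i) (opposite-involutive j))

staircase↔alternative : ∀ n → Inverse (StaircaseαβSetoid n) (AlternativeTableauSetoid n)
staircase↔alternative n = mkInverse (StaircaseαβSetoid n) (AlternativeTableauSetoid n)
  toAlternative toStaircase
  (λ {S T} → toAlternative-cong {S = S} {T}) (λ {A B} → toStaircase-cong {A = A} {B})
  toAlternative-toStaircase toStaircase-toAlternative

-- Part II: alternative tableaux of length n and permutation tableaux of
-- length n + 1.  The fillings are defined by decidable properties of boxes.

private variable
  P Q : Set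

does-true⇒ : (d : Dec P) → does d ≡ true → P
does-true⇒ (yes p) _ = p

does-false⇒ : (d : Dec P) → does d ≡ false → ¬ P
does-false⇒ (no ¬p) _ = ¬p

does-reflects : (d : Dec P) {b : Bool} → (P → b ≡ true) → (b ≡ true → P) → does d ≡ b
does-reflects d {true}  _    from = dec-true d (from refl)
does-reflects d {false} into _    = dec-false d (λ p → case into p of λ ())

least : ∀ {m} (R : Fin m → Set) → (∀ x → Dec (R x)) → ∀ x → R x →
        ∃ λ y → R y × toℕ y ≤ toℕ x × (∀ z → toℕ z < toℕ y → ¬ R z)
least {suc m} R R? x rx with R? zero
... | yes r0 = zero , r0 , z≤n , λ _ ()
least {suc m} R R? zero    rx | no ¬r0 = ⊥-elim (¬r0 rx)
least {suc m} R R? (suc x) rx | no ¬r0 with least (R ∘ suc) (R? ∘ suc) x rx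
... | y , ry , y≤x , below = suc y , ry , s≤s y≤x , λ
  { zero    _         → ¬r0
  ; (suc z) (s≤s z<y) → below z z<y }

_≟ˢ_ : (s t : Step) → Dec (s ≡ t)
south ≟ˢ south = yes refl
south ≟ˢ west  = no λ ()
west  ≟ˢ south = no λ ()
west  ≟ˢ west  = yes refl

_≟ᵃ_ : (x : Maybe Arrow) (a : Arrow) → Dec (x ≡ just a)
just leftArrow ≟ᵃ leftArrow = yes refl
just leftArrow ≟ᵃ upArrow   = no λ ()
just upArrow   ≟ᵃ leftArrow = no λ ()
just upArrow   ≟ᵃ upArrow   = yes refl
nothing        ≟ᵃ _         = no λ ()

Box? : ∀ {N} (w : Path N) p q → Dec (Box w p q)
Box? w p q = (toℕ p <? toℕ q) ×-dec ((w p ≟ˢ south) ×-dec (w q ≟ˢ west))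

module _ {N : ℕ} (v : Path N) (g : Fin N → Fin N → Bool) where

  Covered : Fin N → Fin N → Set
  Covered r c = ∃ λ r' → Box v r' c × toℕ r' < toℕ r × g r' c ≡ true

  TopOne : Fin N → Fin N → Set
  TopOne r c = g r c ≡ true × ¬ Covered r c

  RightmostCoveredZero : Fin N → Fin N → Set
  RightmostCoveredZero r c = g r c ≡ false × Covered r c ×
    (∀ c' → Box v r c' → toℕ c' < toℕ c → Covered r c' → g r c' ≡ true)

  Covered? : ∀ r c → Dec (Covered r c)
  Covered? r c = any? λ r' → Box? v r' c ×-dec ((toℕ r' <? toℕ r) ×-dec (g r' c ≟ᵇ true))

  TopOne? : ∀ r c → Dec (TopOne r c)
  TopOne? r c = (g r c ≟ᵇ true) ×-dec ¬? (Covered? r c)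

  RightmostCoveredZero? : ∀ r c → Dec (RightmostCoveredZero r c)
  RightmostCoveredZero? r c = (g r c ≟ᵇ false) ×-dec (Covered? r c ×-dec
    all? λ c' → Box? v r c' →-dec ((toℕ c' <? toℕ c) →-dec (Covered? r c' →-dec (g r c' ≟ᵇ true))))

extendedPath : ∀ {n} → Path n → Path (suc n)
extendedPath w zero    = south
extendedPath w (suc p) = w p

module _ {n : ℕ} (w : Path n) (f : Fin n → Fin n → Maybe Arrow) where

  Up Left : Fin n → Fin n → Set
  Up   p q = Box w p q × f p q ≡ just upArrow
  Left p q = Box w p q × f p q ≡ just leftArrow

  UpAtOrBelow : Fin n → Fin n → Set
  UpAtOrBelow p q = ∃ λ p' → toℕ p ≤ toℕ p' × Up p' q

  LeftAtOrRightOf : Fin n → Fin n → Set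
  LeftAtOrRightOf p q = ∃ λ q' → toℕ q' ≤ toℕ q × Left p q'

  One : Fin n → Fin n → Set
  One p q = Up p q ⊎ (¬ UpAtOrBelow p q × ¬ LeftAtOrRightOf p q)

  NoUp : Fin n → Set
  NoUp q = ¬ ∃ λ p → Up p q

  Up? : ∀ p q → Dec (Up p q)
  Up? p q = Box? w p q ×-dec (f p q ≟ᵃ upArrow)

  Left? : ∀ p q → Dec (Left p q)
  Left? p q = Box? w p q ×-dec (f p q ≟ᵃ leftArrow)

  UpAtOrBelow? : ∀ p q → Dec (UpAtOrBelow p q)
  UpAtOrBelow? p q = any? λ p' → (toℕ p ≤? toℕ p') ×-dec Up? p' q

  LeftAtOrRightOf? : ∀ p q → Dec (LeftAtOrRightOf p q)
  LeftAtOrRightOf? p q = any? λ q' → (toℕ q' ≤? toℕ q) ×-dec Left? p q'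

  One? : ∀ p q → Dec (One p q)
  One? p q = Up? p q ⊎-dec (¬? (UpAtOrBelow? p q) ×-dec ¬? (LeftAtOrRightOf? p q))

  NoUp? : ∀ q → Dec (NoUp q)
  NoUp? q = ¬? (any? λ p → Up? p q)

  pointed-unless-one : ∀ {p q} → ¬ One p q → UpAtOrBelow p q ⊎ LeftAtOrRightOf p q
  pointed-unless-one {p} {q} ¬one with UpAtOrBelow? p q | LeftAtOrRightOf? p q
  ... | yes upBelow | _          = inj₁ upBelow
  ... | no _        | yes leftOf = inj₂ leftOf
  ... | no noUp     | no noLeft  = ⊥-elim (¬one (inj₂ (noUp , noLeft)))

  ones : Fin (suc n) → Fin (suc n) → Bool
  ones _       zero    = false
  ones zero    (suc q) = does (NoUp? q)
  ones (suc p) (suc q) = does (One? p q)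

Box-suc : ∀ {n} (v : Path (suc n)) {p q} → Box (v ∘ suc) p q → Box v (suc p) (suc q)
Box-suc _ (p<q , wp , wq) = s≤s p<q , wp , wq

Box-pred : ∀ {n} (v : Path (suc n)) {p q} → Box v (suc p) (suc q) → Box (v ∘ suc) p q
Box-pred _ (s≤s p<q , wp , wq) = p<q , wp , wq

module AlternativeToPermutation {n : ℕ} (A : AlternativeTableau n) where
  open AlternativeTableau A renaming (path to w; fill to f)
  open IsAlternativeTableau isAlt

  v : Path (suc n)
  v = extendedPath w

  g : Fin (suc n) → Fin (suc n) → Bool
  g = ones w f

  upAtOrBelow⇒uncovered : ∀ {p q} → UpAtOrBelow w f p q → ¬ Covered v g (suc p) (suc q)
  upAtOrBelow⇒uncovered (p* , _ , up*) (zero , _ , _ , one) = does-true⇒ (NoUp? w f _) one (p* , up*)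
  upAtOrBelow⇒uncovered {p} {q} (p* , p≤p* , box* , up*) (suc p₁ , box₁ , s≤s p₁<p , one)
    with does-true⇒ (One? w f p₁ q) one
  ... | inj₁ (_ , up₁) = case trans (sym (aboveEmpty p* q box* up* p₁ (Box-pred v box₁)
                                   (<-≤-trans p₁<p p≤p*))) up₁ of λ ()
  ... | inj₂ (noUp , _) = noUp (p* , ≤-trans (<⇒≤ p₁<p) p≤p* , box* , up*)

  leftAtOrRightOf⇒noOneLeft : ∀ {p q} → LeftAtOrRightOf w f p q →
    ¬ (∃ λ c → Box v (suc p) c × toℕ (suc q) < toℕ c × g (suc p) c ≡ true)
  leftAtOrRightOf⇒noOneLeft {p} {q} (q* , q*≤q , box* , left*) (suc q₁ , box₁ , s≤s q<q₁ , one)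
    with does-true⇒ (One? w f p q₁) one
  ... | inj₁ (_ , up₁) = case trans (sym (leftEmpty p q* box* left* q₁ (Box-pred v box₁)
                                   (≤-<-trans q*≤q q<q₁))) up₁ of λ ()
  ... | inj₂ (_ , noLeft) = noLeft (q* , ≤-trans q*≤q (<⇒≤ q<q₁) , box* , left*)

  -- a box with no ↑ weakly below it has a 1 above it: the lowest ↑ of its
  -- column, or else the top row
  covered-unless-upAtOrBelow : ∀ {p q} → w q ≡ west → ¬ UpAtOrBelow w f p q →
                               Covered v g (suc p) (suc q)
  covered-unless-upAtOrBelow {p} {q} wq noUpBelow with any? (λ p' → Up? w f p' q)
  ... | no noUp = zero , (s≤s z≤n , refl , wq) , s≤s z≤n , dec-true (NoUp? w f q) noUp
  ... | yes (p' , up') with toℕ p' <? toℕ p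
  ...   | yes p'<p = suc p' , Box-suc v (proj₁ up') , s≤s p'<p , dec-true (One? w f p' q) (inj₁ up')
  ...   | no p'≮p  = ⊥-elim (noUpBelow (p' , ≮⇒≥ p'≮p , up'))

  isPermutation : IsPermutationTableau v g
  isPermutation = record { columnHasOne = columnHasOne ; noBadZero = noBadZero }
    where
    columnHasOne : ∀ c → v c ≡ west → ∃ λ r → Box v r c × g r c ≡ true
    columnHasOne zero ()
    columnHasOne (suc q) wq with any? (λ p → Up? w f p q)
    ... | yes (p , up) = suc p , Box-suc v (proj₁ up) , dec-true (One? w f p q) (inj₁ up)
    ... | no noUp      = zero , (s≤s z≤n , refl , wq) , dec-true (NoUp? w f q) noUp
    -- a 0 is not a 1, so an arrow points to it, which forbids a 1 above it
    -- (an ↑) or a 1 to its left (a ←)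
    noBadZero : ∀ r c → Box v r c → g r c ≡ false → Covered v g r c →
      (∃ λ c' → Box v r c' × toℕ c < toℕ c' × g r c' ≡ true) → ⊥
    noBadZero r       zero    (() , _)
    noBadZero zero    (suc q) _ _ (_ , _ , () , _)
    noBadZero (suc p) (suc q) _ isZero covered oneLeft
      with pointed-unless-one w f (does-false⇒ (One? w f p q) isZero)
    ... | inj₁ upBelow = upAtOrBelow⇒uncovered upBelow covered
    ... | inj₂ leftOf  = leftAtOrRightOf⇒noOneLeft leftOf oneLeft

  up⇒topOne : ∀ {p q} → Up w f p q → TopOne v g (suc p) (suc q)
  up⇒topOne {p} {q} up = dec-true (One? w f p q) (inj₁ up) , upAtOrBelow⇒uncovered (p , ≤-refl , up)

  topOne⇒up : ∀ {p q} → Box w p q → TopOne v g (suc p) (suc q) → f p q ≡ just upArrow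
  topOne⇒up {p} {q} (_ , _ , wq) (one , uncovered) with does-true⇒ (One? w f p q) one
  ... | inj₁ (_ , up)   = up
  ... | inj₂ (noUp , _) = ⊥-elim (uncovered (covered-unless-upAtOrBelow wq noUp))

  left⇒zero : ∀ {p q} → Left w f p q → g (suc p) (suc q) ≡ false
  left⇒zero {p} {q} left@(_ , isLeft) = dec-false (One? w f p q) λ
    { (inj₁ (_ , isUp))    → case trans (sym isUp) isLeft of λ ()
    ; (inj₂ (_ , noLeft)) → noLeft (q , ≤-refl , left) }

  -- an ↑ weakly below a ← would empty it
  left⇒covered : ∀ {p q} → Left w f p q → Covered v g (suc p) (suc q)
  left⇒covered {p} {q} (box@(_ , _ , wq) , isLeft) = covered-unless-upAtOrBelow wq λ
    (p' , p≤p' , box' , isUp) → case m≤n⇒m<n∨m≡n p≤p' of λ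
      { (inj₁ p<p') → case trans (sym (aboveEmpty p' q box' isUp p box p<p')) isLeft of λ ()
      ; (inj₂ p≡p') → case trans (sym isUp)
                             (subst (λ x → f x q ≡ just leftArrow) (toℕ-injective p≡p') isLeft) of λ () }

  left⇒rightmostCoveredZero : ∀ {p q} → Left w f p q → RightmostCoveredZero v g (suc p) (suc q)
  left⇒rightmostCoveredZero {p} {q} left@(box , isLeft) = left⇒zero left , left⇒covered left , rightOnes
    where
    -- a covered box to the right of a ← is a 1, as no arrow points to it
    rightOnes : ∀ c' → Box v (suc p) c' → toℕ c' < suc (toℕ q) → Covered v g (suc p) c' →
                g (suc p) c' ≡ true
    rightOnes (suc q') _ (s≤s q'<q) covered' = dec-true (One? w f p q') (inj₂
      ( (λ upBelow → upAtOrBelow⇒uncovered upBelow covered')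
      , (λ (q'' , q''≤q' , box'' , isLeft'') →
           case trans (sym (leftEmpty p q'' box'' isLeft'' q box (≤-<-trans q''≤q' q'<q))) isLeft
           of λ ())))

  rightmostCoveredZero⇒left : ∀ {p q} → Box w p q → RightmostCoveredZero v g (suc p) (suc q) →
                              f p q ≡ just leftArrow
  rightmostCoveredZero⇒left {p} {q} _ (isZero , covered , rightOnes)
    with pointed-unless-one w f (does-false⇒ (One? w f p q) isZero)
  ... | inj₁ upBelow = ⊥-elim (upAtOrBelow⇒uncovered upBelow covered)
  ... | inj₂ (q* , q*≤q , left*) with m≤n⇒m<n∨m≡n q*≤q
  ...   | inj₂ q*≡q = subst (λ x → f p x ≡ just leftArrow) (toℕ-injective q*≡q) (proj₂ left*)
  ...   | inj₁ q*<q = case trans (sym (rightOnes (suc q*) (Box-suc v (proj₁ left*)) (s≤s q*<q)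
                                             (left⇒covered left*))) (left⇒zero left*) of λ ()

toPermutation : ∀ {n} → AlternativeTableau n → PermutationTableau (suc n)
toPermutation A = record { path = v ; fill = g ; isPerm = isPermutation }
  where open AlternativeToPermutation A

arrowOf : Bool → Bool → Maybe Arrow
arrowOf true  _     = just upArrow
arrowOf false true  = just leftArrow
arrowOf false false = nothing

arrowOf-up⇒ : (d : Dec P) (e : Dec Q) → arrowOf (does d) (does e) ≡ just upArrow → P
arrowOf-up⇒ (yes p) _      _ = p
arrowOf-up⇒ (no _)  (yes _) ()
arrowOf-up⇒ (no _)  (no _)  ()

arrowOf-left⇒ : (d : Dec P) (e : Dec Q) → arrowOf (does d) (does e) ≡ just leftArrow → ¬ P × Q
arrowOf-left⇒ (yes _)  _      ()
arrowOf-left⇒ (no ¬p) (yes q) _ = ¬p , q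
arrowOf-left⇒ (no _)  (no _)  ()

module _ (d : Dec P) (e : Dec Q) where

  arrowOf-up : P → arrowOf (does d) (does e) ≡ just upArrow
  arrowOf-up p rewrite dec-true d p = refl

  arrowOf-left : ¬ P → Q → arrowOf (does d) (does e) ≡ just leftArrow
  arrowOf-left ¬p q rewrite dec-false d ¬p | dec-true e q = refl

  arrowOf-nothing : ¬ P → ¬ Q → arrowOf (does d) (does e) ≡ nothing
  arrowOf-nothing ¬p ¬q rewrite dec-false d ¬p | dec-false e ¬q = refl

  arrowOf-unique : ∀ x → (P → x ≡ just upArrow) → (x ≡ just upArrow → P) →
    (Q → x ≡ just leftArrow) → (x ≡ just leftArrow → Q) → arrowOf (does d) (does e) ≡ x
  arrowOf-unique (just upArrow)   _  fromUp _ _ = arrowOf-up (fromUp refl)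
  arrowOf-unique (just leftArrow) toUp _ _ fromLeft =
    arrowOf-left (λ p → case toUp p of λ ()) (fromLeft refl)
  arrowOf-unique nothing toUp _ toLeft _ =
    arrowOf-nothing (λ p → case toUp p of λ ()) (λ q → case toLeft q of λ ())

module PermutationToAlternative {n : ℕ} (T : PermutationTableau (suc n)) where
  open PermutationTableau T renaming (path to v; fill to g)
  open IsPermutationTableau isPerm

  w : Path n
  w p = v (suc p)

  arrows : Fin n → Fin n → Maybe Arrow
  arrows p q = arrowOf (does (TopOne? v g (suc p) (suc q)))
                       (does (RightmostCoveredZero? v g (suc p) (suc q)))

  -- position 0 is a row, since a column there would have no box for its 1
  topRow-south : v zero ≡ south
  topRow-south with v zero in e
  ... | south = refl
  ... | west with columnHasOne zero e
  ...   | _ , (() , _) , _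

  topOne-exists : ∀ c → v c ≡ west → ∃ λ r → Box v r c × TopOne v g r c
  topOne-exists c vc with columnHasOne c vc
  ... | r , box , one with least (λ r → Box v r c × g r c ≡ true)
                                 (λ r → Box? v r c ×-dec (g r c ≟ᵇ true)) r (box , one)
  ...   | r* , (box* , one*) , _ , above = r* , box* , one* , λ (r' , box' , r'<r* , one') →
                                             above r' r'<r* (box' , one')

  rightmostCoveredZero-exists : ∀ {r c} → Box v r c → Covered v g r c → g r c ≡ false →
    ∃ λ c* → Box v r c* × toℕ c* ≤ toℕ c × RightmostCoveredZero v g r c*
  rightmostCoveredZero-exists {r} {c} box covered isZero
    with least (λ c' → Box v r c' × Covered v g r c' × g r c' ≡ false)
               (λ c' → Box? v r c' ×-dec (Covered? v g r c' ×-dec (g r c' ≟ᵇ false)))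
               c (box , covered , isZero)
  ... | c* , (box* , covered* , isZero*) , c*≤c , right =
    c* , box* , c*≤c , isZero* , covered* , λ c' box' c'<c* covered' →
      ¬-not λ isZero' → right c' c'<c* (box' , covered' , isZero')

  isAlternative : IsAlternativeTableau w arrows
  isAlternative = record { leftEmpty = leftEmpty ; aboveEmpty = aboveEmpty }
    where
    -- left of a rightmost covered 0 there are only 0's (no bad zero), none
    -- of them rightmost
    leftEmpty : ∀ p q → Box w p q → arrows p q ≡ just leftArrow →
      ∀ q' → Box w p q' → toℕ q < toℕ q' → arrows p q' ≡ nothing
    leftEmpty p q (p<q , wp , wq) e q' (p<q' , _ , wq') q<q'
      with arrowOf-left⇒ (TopOne? v g (suc p) (suc q)) (RightmostCoveredZero? v g (suc p) (suc q)) e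
    ... | _ , (isZero , covered , _) =
      arrowOf-nothing (TopOne? v g (suc p) (suc q')) (RightmostCoveredZero? v g (suc p) (suc q'))
        (λ (one , _) → noBadZero _ _ (s≤s p<q , wp , wq) isZero covered
                         (suc q' , (s≤s p<q' , wp , wq') , s≤s q<q' , one))
        (λ (_ , _ , right) → case trans (sym (right (suc q) (s≤s p<q , wp , wq) (s≤s q<q') covered))
                                        isZero of λ ())
    -- above a topmost 1 nothing is covered
    aboveEmpty : ∀ p q → Box w p q → arrows p q ≡ just upArrow →
      ∀ p' → Box w p' q → toℕ p' < toℕ p → arrows p' q ≡ nothing
    aboveEmpty p q _ e p' (p'<q , wp' , wq) p'<p
      with arrowOf-up⇒ (TopOne? v g (suc p) (suc q)) (RightmostCoveredZero? v g (suc p) (suc q)) e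
    ... | _ , uncovered =
      arrowOf-nothing (TopOne? v g (suc p') (suc q)) (RightmostCoveredZero? v g (suc p') (suc q))
        (λ (one , _) → uncovered (suc p' , (s≤s p'<q , wp' , wq) , s≤s p'<p , one))
        (λ (_ , (r , box , r<p' , one) , _) → uncovered (r , box , <-trans r<p' (s≤s p'<p) , one))

  up⇒topOne : ∀ {p q} → Up w arrows p q → TopOne v g (suc p) (suc q)
  up⇒topOne {p} {q} (_ , isUp) =
    arrowOf-up⇒ (TopOne? v g (suc p) (suc q)) (RightmostCoveredZero? v g (suc p) (suc q)) isUp

  topOne⇒up : ∀ {p q} → Box w p q → TopOne v g (suc p) (suc q) → Up w arrows p q
  topOne⇒up {p} {q} box top =
    box , arrowOf-up (TopOne? v g (suc p) (suc q)) (RightmostCoveredZero? v g (suc p) (suc q)) top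

  left⇒rightmostCoveredZero : ∀ {p q} → Left w arrows p q → RightmostCoveredZero v g (suc p) (suc q)
  left⇒rightmostCoveredZero {p} {q} (_ , isLeft) =
    proj₂ (arrowOf-left⇒ (TopOne? v g (suc p) (suc q)) (RightmostCoveredZero? v g (suc p) (suc q)) isLeft)

  rightmostCoveredZero⇒left : ∀ {p q} → Box w p q → RightmostCoveredZero v g (suc p) (suc q) →
                              Left w arrows p q
  rightmostCoveredZero⇒left {p} {q} box rcz@(isZero , _) =
    box , arrowOf-left (TopOne? v g (suc p) (suc q)) (RightmostCoveredZero? v g (suc p) (suc q))
            (λ (one , _) → case trans (sym one) isZero of λ ()) rcz

  noUp⇒topRowOne : ∀ q → w q ≡ west → NoUp w arrows q → g zero (suc q) ≡ true
  noUp⇒topRowOne q wq noUp with topOne-exists (suc q) wq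
  ... | zero    , _    , one , _ = one
  ... | suc p* , box* , top*    = ⊥-elim (noUp (p* , topOne⇒up (Box-pred v box*) top*))

  topRowOne⇒noUp : ∀ q → w q ≡ west → g zero (suc q) ≡ true → NoUp w arrows q
  topRowOne⇒noUp q wq one (p , up) =
    proj₂ (up⇒topOne up) (zero , (s≤s z≤n , topRow-south , wq) , s≤s z≤n , one)

  -- the other rows: a 1 is an ↑ or has no arrow pointing to it ...
  one⇒One : ∀ {p q} → Box w p q → g (suc p) (suc q) ≡ true → One w arrows p q
  one⇒One {p} {q} box one with Covered? v g (suc p) (suc q)
  ... | no uncovered = inj₁ (topOne⇒up box (one , uncovered))
  ... | yes covered  = inj₂ (noUpBelow , noLeftOf)
    where
    noUpBelow : ¬ UpAtOrBelow w arrows p q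
    noUpBelow (p' , p≤p' , up') with up⇒topOne up' | m≤n⇒m<n∨m≡n p≤p'
    ... | _ , uncovered' | inj₁ p<p' = uncovered' (suc p , Box-suc v box , s≤s p<p' , one)
    ... | _ , uncovered' | inj₂ p≡p' =
      uncovered' (subst (λ x → Covered v g (suc x) (suc q)) (toℕ-injective p≡p') covered)
    noLeftOf : ¬ LeftAtOrRightOf w arrows p q
    noLeftOf (q' , q'≤q , left') with left⇒rightmostCoveredZero left' | m≤n⇒m<n∨m≡n q'≤q
    ... | isZero' , covered' , _ | inj₁ q'<q =
      noBadZero (suc p) (suc q') (Box-suc v (proj₁ left')) isZero' covered'
        (suc q , Box-suc v box , s≤s q'<q , one)
    ... | isZero' , _ | inj₂ q'≡q =
      case trans (sym one) (subst (λ x → g (suc p) (suc x) ≡ false) (toℕ-injective q'≡q) isZero')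
      of λ ()

  -- ... and a 0 is pointed to by an arrow: the rightmost covered 0 to its
  -- right if it is covered, and otherwise the topmost 1 below it
  zero⇒pointed : ∀ {p q} → Box w p q → g (suc p) (suc q) ≡ false →
                 UpAtOrBelow w arrows p q ⊎ LeftAtOrRightOf w arrows p q
  zero⇒pointed {p} {q} box@(_ , _ , wq) isZero with Covered? v g (suc p) (suc q)
  ... | yes covered with rightmostCoveredZero-exists (Box-suc v box) covered isZero
  ...   | suc q* , box* , s≤s q*≤q , rcz =
    inj₂ (q* , q*≤q , rightmostCoveredZero⇒left (Box-pred v box*) rcz)
  zero⇒pointed {p} {q} box@(_ , _ , wq) isZero | no uncovered with topOne-exists (suc q) wq
  ... | r* , box* , top*@(one* , _) with <-cmp (toℕ r*) (suc (toℕ p))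
  ...   | tri< r*<r _ _ = ⊥-elim (uncovered (r* , box* , r*<r , one*))
  ...   | tri≈ _ r*≡r _ = case trans (sym one*) (subst (λ x → g x (suc q) ≡ false)
                                                  (toℕ-injective (sym r*≡r)) isZero) of λ ()
  zero⇒pointed box isZero | no _ | suc p* , box* , top* | tri> _ _ (s≤s p<p*) =
    inj₁ (p* , <⇒≤ p<p* , topOne⇒up (Box-pred v box*) top*)

  One⇒one : ∀ {p q} → Box w p q → One w arrows p q → g (suc p) (suc q) ≡ true
  One⇒one _   (inj₁ up) = proj₁ (up⇒topOne up)
  One⇒one box (inj₂ (noUpBelow , noLeftOf)) = ¬-not λ isZero → case zero⇒pointed box isZero of λ
    { (inj₁ upBelow) → noUpBelow upBelow
    ; (inj₂ leftOf)  → noLeftOf leftOf }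

fromPermutation : ∀ {n} → PermutationTableau (suc n) → AlternativeTableau n
fromPermutation T = record { path = w ; fill = arrows ; isAlt = isAlternative }
  where open PermutationToAlternative T

fromPermutation-toPermutation : ∀ {n} (A : AlternativeTableau n) → fromPermutation (toPermutation A) ≈At A
fromPermutation-toPermutation A = (λ _ → refl) , λ p q box →
  arrowOf-unique (TopOne? v g (suc p) (suc q)) (RightmostCoveredZero? v g (suc p) (suc q)) (f p q)
    (topOne⇒up box) (λ isUp → up⇒topOne (box , isUp))
    (rightmostCoveredZero⇒left box) (λ isLeft → left⇒rightmostCoveredZero (box , isLeft))
  where
  open AlternativeTableau A using () renaming (fill to f)
  open AlternativeToPermutation A

toPermutation-fromPermutation : ∀ {n} (T : PermutationTableau (suc n)) →
                                toPermutation (fromPermutation T) ≈Pt T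
toPermutation-fromPermutation T = pathEq , fillEq
  where
  open PermutationTableau T using () renaming (path to v; fill to g)
  open PermutationToAlternative T
  pathEq : ∀ r → extendedPath w r ≡ v r
  pathEq zero    = sym topRow-south
  pathEq (suc p) = refl
  fillEq : ∀ r c → Box (extendedPath w) r c → ones w arrows r c ≡ g r c
  fillEq _       zero    (() , _)
  fillEq zero    (suc q) (_ , _ , wq) =
    does-reflects (NoUp? w arrows q) (noUp⇒topRowOne q wq) (topRowOne⇒noUp q wq)
  fillEq (suc p) (suc q) box =
    does-reflects (One? w arrows p q) (One⇒one (Box-pred v box)) (one⇒One (Box-pred v box))

module _ {n : ℕ} (A B : AlternativeTableau n) (A≈B : A ≈At B) where
  private
    module A = AlternativeTableau A
    module B = AlternativeTableau B

  content-resp : ∀ {p q x} → Box A.path p q × A.fill p q ≡ x → Box B.path p q × B.fill p q ≡ x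
  content-resp {p} {q} (box , e) = Box-resp (proj₁ A≈B) box , trans (sym (proj₂ A≈B p q box)) e

module _ {n : ℕ} (A B : AlternativeTableau n) (A≈B : A ≈At B) where
  private
    module A = AlternativeTableau A
    module B = AlternativeTableau B
    B≈A = Setoid.sym (AlternativeTableauSetoid n) {A} {B} A≈B

  One-resp : ∀ {p q} → One A.path A.fill p q → One B.path B.fill p q
  One-resp (inj₁ up) = inj₁ (content-resp A B A≈B up)
  One-resp (inj₂ (noUp , noLeft)) = inj₂
    ( (λ (p' , le , up') → noUp (p' , le , content-resp B A B≈A up'))
    , (λ (q' , le , left') → noLeft (q' , le , content-resp B A B≈A left')) )

  NoUp-resp : ∀ {q} → NoUp A.path A.fill q → NoUp B.path B.fill q
  NoUp-resp noUp (p , up) = noUp (p , content-resp B A B≈A up)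

module _ {N : ℕ} (T T' : PermutationTableau N) (T≈T' : T ≈Pt T') where
  private
    module T = PermutationTableau T
    module T' = PermutationTableau T'

  Covered-resp : ∀ {r c} → Covered T.path T.fill r c → Covered T'.path T'.fill r c
  Covered-resp {c = c} (r' , box , r'<r , one) =
    r' , Box-resp (proj₁ T≈T') box , r'<r , trans (sym (proj₂ T≈T' r' c box)) one

module _ {N : ℕ} (T T' : PermutationTableau N) (T≈T' : T ≈Pt T') where
  private
    module T = PermutationTableau T
    module T' = PermutationTableau T'
    T'≈T = Setoid.sym (PermutationTableauSetoid N) {T} {T'} T≈T'

  TopOne-resp : ∀ {r c} → Box T.path r c → TopOne T.path T.fill r c → TopOne T'.path T'.fill r c
  TopOne-resp box (one , uncovered) =
    trans (sym (proj₂ T≈T' _ _ box)) one , uncovered ∘ Covered-resp T' T T'≈T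

  RightmostCoveredZero-resp : ∀ {r c} → Box T.path r c →
    RightmostCoveredZero T.path T.fill r c → RightmostCoveredZero T'.path T'.fill r c
  RightmostCoveredZero-resp {r} box (isZero , covered , rightOnes) =
    trans (sym (proj₂ T≈T' _ _ box)) isZero , Covered-resp T T' T≈T' covered ,
    λ c' box' c'<c covered' → let box'' = Box-resp (proj₁ T'≈T) box' in
      trans (sym (proj₂ T≈T' r c' box'')) (rightOnes c' box'' c'<c (Covered-resp T' T T'≈T covered'))

toPermutation-cong : ∀ {n} {A B : AlternativeTableau n} → A ≈At B → toPermutation A ≈Pt toPermutation B
toPermutation-cong {n} {A} {B} A≈B = pathEq , fillEq
  where
  module A = AlternativeTableau A
  module B = AlternativeTableau B
  B≈A = Setoid.sym (AlternativeTableauSetoid n) {A} {B} A≈B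
  pathEq : ∀ r → extendedPath A.path r ≡ extendedPath B.path r
  pathEq zero    = refl
  pathEq (suc p) = proj₁ A≈B p
  fillEq : ∀ r c → Box (extendedPath A.path) r c → ones A.path A.fill r c ≡ ones B.path B.fill r c
  fillEq _       zero    _ = refl
  fillEq zero    (suc q) _ = does-⇔ (mk⇔ (NoUp-resp A B A≈B {q}) (NoUp-resp B A B≈A {q}))
    (NoUp? A.path A.fill q) (NoUp? B.path B.fill q)
  fillEq (suc p) (suc q) _ = does-⇔ (mk⇔ (One-resp A B A≈B {p} {q}) (One-resp B A B≈A {p} {q}))
    (One? A.path A.fill p q) (One? B.path B.fill p q)

fromPermutation-cong : ∀ {n} {T T' : PermutationTableau (suc n)} → T ≈Pt T' →
                       fromPermutation T ≈At fromPermutation T'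
fromPermutation-cong {n} {T} {T'} T≈T' = (λ p → proj₁ T≈T' (suc p)) , λ p q box →
  let box₁ = Box-suc T.path box
      box₂ = Box-resp (proj₁ T≈T') box₁ in
  cong₂ arrowOf
    (does-⇔ (mk⇔ (TopOne-resp T T' T≈T' box₁) (TopOne-resp T' T T'≈T box₂))
      (TopOne? T.path T.fill _ _) (TopOne? T'.path T'.fill _ _))
    (does-⇔ (mk⇔ (RightmostCoveredZero-resp T T' T≈T' box₁) (RightmostCoveredZero-resp T' T T'≈T box₂))
      (RightmostCoveredZero? T.path T.fill _ _) (RightmostCoveredZero? T'.path T'.fill _ _))
  where
  module T = PermutationTableau T
  module T' = PermutationTableau T'
  T'≈T = Setoid.sym (PermutationTableauSetoid (suc n)) {T} {T'} T≈T'

alternative↔permutation : ∀ n → Inverse (AlternativeTableauSetoid n) (PermutationTableauSetoid (suc n))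
alternative↔permutation n = mkInverse (AlternativeTableauSetoid n) (PermutationTableauSetoid (suc n))
  toPermutation fromPermutation
  (λ {A B} → toPermutation-cong {A = A} {B}) (λ {T T'} → fromPermutation-cong {T = T} {T'})
  toPermutation-fromPermutation fromPermutation-toPermutation

proposition9p3 : (n : ℕ) → 1 ≤ n →
    Bijection (StaircaseαβSetoid n) (PermutationTableauSetoid (suc n))
    × Bijection (StaircaseαβSetoid n) (AlternativeTableauSetoid n)
proposition9p3 n _ =
    Inverse⇒Bijection (staircase↔alternative n ∘ᵢ alternative↔permutation n)
  , Inverse⇒Bijection (staircase↔alternative n)
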